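{- For every $A \subseteq [n]$, we have $w([\emptyset, A]) = w([\emptyset, A)) + 1$ if and only if $A$ is a special point; here $[\emptyset, A) = \{B \subseteq [n] : B <_b A\}$ and $[\emptyset, A] = [\emptyset, A) \cup \{A\}$.
   Context: The binary order $<_b$ on subsets of $[n]=\{1,\dots,n\}$: $A <_b B$ if $\max(A \triangle B) \in B$. The width $w(\mathcal{X})$ is the maximum size of an antichain (with respect to inclusion) in $\mathcal{X}$. Identify $A \subseteq [n]$ with its 0-1 sequence $a_1 \cdots a_n$ ($a_j=1$ iff $j\in A$). Pairing procedure: scan positions left to right; a scanned 0 becomes unpaired; a scanned 1 is paired with the rightmost currently unpaired 0 to its left if one exists (both become paired), otherwise it remains unpaired. $A$ is a special point if its sequence has no unpaired 1's. -}

module Defs where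

open import Data.Nat using (ℕ; zero; suc; _+_)
open import Data.Bool using (Bool; true; false; _xor_)
open import Data.Fin using (Fin; _≤_)
open import Data.Vec using (Vec; []; _∷_; zipWith)
open import Data.Fin.Subset using (Subset; _∈_; _∉_; _⊆_; inside; outside)
open import Data.List using (List; length)
open import Data.List.Relation.Unary.All using (All)
open import Data.List.Relation.Unary.AllPairs using (AllPairs)
open import Data.Product using (_×_; ∃)
open import Relation.Nullary using (¬_)
open import Relation.Binary.PropositionalEquality using (_≡_)

-- A subset A ⊆ [n] is a vector of length n; position i (i : Fin n,
-- 0-based) stands for the element toℕ i + 1.  Thus the vector read from
-- index 0 upwards is exactly the 0-1 sequence a₁ ⋯ aₙ, and the order on
-- Fin n is the order on [n].

_△_ : ∀ {n} → Subset n → Subset n → Subset n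
A △ B = zipWith _xor_ A B

_<b_ : ∀ {n} → Subset n → Subset n → Set
_<b_ {n} A B = ∃ λ (i : Fin n) →
  (i ∈ (A △ B)) × (∀ (j : Fin n) → j ∈ (A △ B) → j ≤ i) × (i ∈ B)

halfOpen : ∀ {n} → Subset n → Subset n → Set
halfOpen A B = B <b A

closed : ∀ {n} → Subset n → Subset n → Set
closed A B = (B <b A) Data.Sum.⊎ (B ≡ A)
  where import Data.Sum

-- an antichain (w.r.t. inclusion) inside the family X, given as a list of
-- pairwise incomparable (hence pairwise distinct) members of X
IsAntichainIn : ∀ {n} → (Subset n → Set) → List (Subset n) → Set
IsAntichainIn X L =
  All X L × AllPairs (λ B C → ¬ (B ⊆ C) × ¬ (C ⊆ B)) L

IsWidth : ∀ {n} → (Subset n → Set) → ℕ → Set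
IsWidth X k =
  (∃ λ L → IsAntichainIn X L × length L ≡ k) ×
  (∀ L → IsAntichainIn X L → length L Data.Nat.≤ k)
  where import Data.Nat

-- pairing procedure: scan left to right, keeping the number u of currently
-- unpaired 0's (only their number matters for whether a 1 gets paired; the
-- one paired is the rightmost).
unpairedOnes : ∀ {m} → ℕ → Vec Bool m → ℕ
unpairedOnes u [] = 0
unpairedOnes u (false ∷ a) = unpairedOnes (suc u) a
unpairedOnes zero (true ∷ a) = suc (unpairedOnes zero a)
unpairedOnes (suc u) (true ∷ a) = unpairedOnes u a

Special : ∀ {n} → Subset n → Set
Special A = unpairedOnes 0 A ≡ 0

-- Use the symmetric chain decomposition of de Bruijn, Tengbergen and Kruyswijk, built by
-- adding the elements of [n] in increasing order: a chain C₀ ⊂ ⋯ ⊂ Cₖ of subsets of [m]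
-- gives the chains C₀ ⊂ ⋯ ⊂ Cₖ ⊂ Cₖ ∪ {m+1} and C₀ ∪ {m+1} ⊂ ⋯ ⊂ Cₖ₋₁ ∪ {m+1}.
-- The binary order is decided at the largest element, so its initial segments follow the
-- same recursion, and the width of a segment is the number of chains meeting it: an
-- antichain meets each chain at most once, and conversely one element of each such chain
-- can be chosen so that these form an antichain inside the segment.  Going from [∅, A) to
-- [∅, A] adds a chain exactly when A is the bottom of its chain, and the bottoms are the
-- sets without unpaired 1's, because (unpaired 0's of B) + |B| + |bottom B| = n.
module Submission where

open import Defs

open import Data.Bool using (Bool; true; false; not; _∧_; _xor_; T; if_then_else_; f≤t; b≤b)
  renaming (_≤_ to _≤ᵇ_)
open import Data.Bool.Properties using (T-∧; T-≡; xor-same)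
open import Data.Empty using (⊥-elim)
open import Data.Fin using (Fin; zero; suc)
open import Data.Fin.Subset using (Subset; _⊆_) renaming (_∈_ to _∈ˢ_; _∉_ to _∉ˢ_)
open import Data.Fin.Subset.Properties using (drop-∷-⊆; out⊆; in⊆in; drop-there; ∉⊥)
open import Data.List using (List; []; _∷_; [_]; map; _++_; filter; length)
open import Data.List.Membership.Propositional using (_∈_)
open import Data.List.Membership.Propositional.Properties
  using (∈-++⁺ˡ; ∈-++⁺ʳ; ∈-++⁻; ∈-map⁺; ∈-map⁻; ∈-filter⁺; ∈-filter⁻)
open import Data.List.Properties
  using ( length-map; length-++; length-removeAt′; map-∘; map-++; map-cong-local; ++-assoc
        ; filter-++; filter-none; filter-all; filter-accept; filter-reject; filter-≐)
open import Data.List.Relation.Unary.All as All using (All)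
import Data.List.Relation.Unary.All.Properties as All
open import Data.List.Relation.Unary.AllPairs as AllPairs using (AllPairs)
import Data.List.Relation.Unary.AllPairs.Properties as AllPairs
open import Data.List.Relation.Unary.Any using (here; there; _─_)
open import Data.List.Relation.Unary.Unique.Propositional using (Unique)
open import Data.Nat
  using (ℕ; zero; suc; pred; _+_; _≤_; _<_; z≤n; s≤s; _≟_; _≤?_; _<?_; _⊓_; ⌊_/2⌋; ⌈_/2⌉)
open import Data.Nat.Properties
open import Data.Product as Product using (_×_; _,_; proj₁; proj₂; ∃)
open import Data.Sum as Sum using (_⊎_; inj₁; inj₂; [_,_]′)
open import Data.Vec using (Vec; []; _∷_; _∷ʳ_; here; there)
open import Function using (_∘_; case_of_)
open import Function.Bundles using (_⇔_; mk⇔; Equivalence)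
open import Function.Properties.Equivalence using () renaming (trans to ⇔-trans; sym to ⇔-sym)
open import Relation.Binary.PropositionalEquality hiding ([_])
open import Relation.Nullary using (¬_; Dec; yes; no; does; proof; Reflects; ofʸ; ofⁿ)
open import Relation.Unary using (Pred; Decidable)
open import Relation.Unary.Properties using (_∩?_)

module _ {a} {X : Set a} where

  ∈-─⁺ : ∀ {x y : X} {ys} (p : x ∈ ys) → y ∈ ys → y ≢ x → y ∈ (ys ─ p)
  ∈-─⁺ (here refl) (here refl) y≢x = ⊥-elim (y≢x refl)
  ∈-─⁺ (here _)    (there q)   _   = q
  ∈-─⁺ (there p)   (here e)    _   = here e
  ∈-─⁺ (there p)   (there q)   y≢x = there (∈-─⁺ p q y≢x)

  unique⊆⇒length≤ : ∀ {xs ys : List X} → Unique xs → All (_∈ ys) xs → length xs ≤ length ys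
  unique⊆⇒length≤ AllPairs.[] All.[] = z≤n
  unique⊆⇒length≤ {ys = ys} (x≢xs AllPairs.∷ xs!) (x∈ys All.∷ xs⊆ys) = ≤-trans
    (s≤s (unique⊆⇒length≤ xs!
      (All.zipWith (λ (x≢y , y∈ys) → ∈-─⁺ x∈ys y∈ys (x≢y ∘ sym)) (x≢xs , xs⊆ys))))
    (≤-reflexive (sym (length-removeAt′ ys _)))

module _ {a b p} {X : Set a} {Y : Set b} {P : Pred Y p} where

  filter-map : (P? : Decidable P) (f : X → Y) (xs : List X) →
               filter P? (map f xs) ≡ map f (filter (P? ∘ f) xs)
  filter-map P? f []       = refl
  filter-map P? f (x ∷ xs) with does (P? (f x))
  ... | true  = cong (f x ∷_) (filter-map P? f xs)
  ... | false = filter-map P? f xs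

module _ {a p q} {X : Set a} {P : Pred X p} {Q : Pred X q} where

  filter-filter : (P? : Decidable P) (Q? : Decidable Q) (xs : List X) →
                  filter P? (filter Q? xs) ≡ filter (Q? ∩? P?) xs
  filter-filter P? Q? []       = refl
  filter-filter P? Q? (x ∷ xs) with does (Q? x)
  ... | false = filter-filter P? Q? xs
  ... | true with does (P? x)
  ...   | true  = cong (x ∷_) (filter-filter P? Q? xs)
  ...   | false = filter-filter P? Q? xs

double≤⇔≤half : ∀ {x m} → x + x ≤ m ⇔ x ≤ ⌊ m /2⌋
double≤⇔≤half {x} {m} = mk⇔
  (λ x+x≤m → ≤-trans (≤-reflexive (n≡⌊n+n/2⌋ x)) (⌊n/2⌋-mono x+x≤m))
  (λ x≤half → ≤-trans (+-mono-≤ x≤half (≤-trans x≤half (⌊n/2⌋≤⌈n/2⌉ m)))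
                      (≤-reflexive (⌊n/2⌋+⌈n/2⌉≡n m)))

double<⇔<half : ∀ {x m} → x + x < m ⇔ x < ⌈ m /2⌉
double<⇔<half {x} {m} = mk⇔
  (λ x+x<m → Equivalence.to double≤⇔≤half (subst (_≤ suc m) (sym 2+x+x≡) (s≤s x+x<m)))
  (λ x<half → ≤-pred (subst (_≤ suc m) 2+x+x≡ (Equivalence.from double≤⇔≤half x<half)))
  where
  2+x+x≡ : suc x + suc x ≡ suc (suc (x + x))
  2+x+x≡ = cong suc (+-suc x x)

-- Sets as words and the chain decomposition

variable
  n m : ℕ
  x y : Bool

-- B ▷ x extends a subset B of [n] to a subset of [n + 1], containing n + 1 iff x.
infixl 5 _▷_
data Bits : ℕ → Set where
  []  : Bits 0
  _▷_ : Bits n → Bool → Bits (suc n)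

variable
  A B C : Bits n

▷-injectiveˡ : B ▷ x ≡ C ▷ y → B ≡ C
▷-injectiveˡ refl = refl

rank : Bits n → ℕ
rank []          = 0
rank (B ▷ false) = rank B
rank (B ▷ true)  = suc (rank B)

rank≤length : (B : Bits n) → rank B ≤ n
rank≤length []          = z≤n
rank≤length (B ▷ false) = m≤n⇒m≤1+n (rank≤length B)
rank≤length (B ▷ true)  = s≤s (rank≤length B)

infix 4 _⊑_
data _⊑_ : Bits n → Bits n → Set where
  []   : [] ⊑ []
  _▷⊑_ : B ⊑ C → x ≤ᵇ y → B ▷ x ⊑ C ▷ y

⊑⇒rank≤ : B ⊑ C → rank B ≤ rank C
⊑⇒rank≤ []                   = z≤n
⊑⇒rank≤ (B⊑C ▷⊑ f≤t)         = m≤n⇒m≤1+n (⊑⇒rank≤ B⊑C)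
⊑⇒rank≤ (B⊑C ▷⊑ b≤b {false}) = ⊑⇒rank≤ B⊑C
⊑⇒rank≤ (B⊑C ▷⊑ b≤b {true})  = s≤s (⊑⇒rank≤ B⊑C)

⊑∧rank≡⇒≡ : B ⊑ C → rank B ≡ rank C → B ≡ C
⊑∧rank≡⇒≡ []                   _ = refl
⊑∧rank≡⇒≡ (B⊑C ▷⊑ f≤t)         e = ⊥-elim (<-irrefl e (s≤s (⊑⇒rank≤ B⊑C)))
⊑∧rank≡⇒≡ (B⊑C ▷⊑ b≤b {false}) e = cong (_▷ false) (⊑∧rank≡⇒≡ B⊑C e)
⊑∧rank≡⇒≡ (B⊑C ▷⊑ b≤b {true})  e = cong (_▷ true) (⊑∧rank≡⇒≡ B⊑C (suc-injective e))

Incomparable : Bits n → Bits n → Set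
Incomparable B C = ¬ B ⊑ C × ¬ C ⊑ B

IsAntichain : (Bits n → Set) → List (Bits n) → Set
IsAntichain P L = All P L × AllPairs Incomparable L

▷-incomparable : Incomparable B C → Incomparable (B ▷ x) (C ▷ x)
▷-incomparable (B⋢C , C⋢B) = (λ { (B⊑C ▷⊑ _) → B⋢C B⊑C }) , (λ { (C⊑B ▷⊑ _) → C⋢B C⊑B })

rank≡∧≢⇒incomparable : rank B ≡ rank C → B ≢ C → Incomparable B C
rank≡∧≢⇒incomparable e B≢C =
  (λ B⊑C → B≢C (⊑∧rank≡⇒≡ B⊑C e)) , (λ C⊑B → B≢C (sym (⊑∧rank≡⇒≡ C⊑B (sym e))))

same-rank⇒incomparable : ∀ {h} {L : List (Bits n)} → All (λ B → rank B ≡ h) L → Unique L →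
                         AllPairs Incomparable L
same-rank⇒incomparable All.[] AllPairs.[] = AllPairs.[]
same-rank⇒incomparable (rB All.∷ rL) (B≢L AllPairs.∷ L!) =
  All.zipWith (λ (rC , B≢C) → rank≡∧≢⇒incomparable (trans rB (sym rC)) B≢C) (rL , B≢L)
  AllPairs.∷ same-rank⇒incomparable rL L!

-- bottom B is the least element of the chain through B, and isTop B tells whether B is its
-- largest element; the chains are symmetric, so that happens iff |B| + |bottom B| = n.
bottom : Bits n → Bits n
isTop  : Bits n → Bool

bottom []          = []
bottom (B ▷ false) = bottom B ▷ false
bottom (B ▷ true)  = bottom B ▷ not (isTop B)

Top : Bits n → Set
Top {n} B = rank B + rank (bottom B) ≡ n

isTop {n} B = does (rank B + rank (bottom B) ≟ n)

isTop-reflects : (B : Bits n) → Reflects (Top B) (isTop B)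
isTop-reflects {n} B = proof (rank B + rank (bottom B) ≟ n)

nonTop⇔¬Top : (B : Bits n) → T (not (isTop B)) ⇔ (¬ Top B)
nonTop⇔¬Top B with isTop B | isTop-reflects B
... | true  | ofʸ top  = mk⇔ (λ ()) (λ ¬top → ¬top top)
... | false | ofⁿ ¬top = mk⇔ (λ _ → ¬top) _

bottom-▷true-top : Top B → bottom (B ▷ true) ≡ bottom B ▷ false
bottom-▷true-top {B = B} top with isTop B | isTop-reflects B
... | true  | _        = refl
... | false | ofⁿ ¬top = ⊥-elim (¬top top)

bottom-▷true-nontop : ¬ Top B → bottom (B ▷ true) ≡ bottom B ▷ true
bottom-▷true-nontop {B = B} ¬top with isTop B | isTop-reflects B
... | true  | ofʸ top = ⊥-elim (¬top top)
... | false | _       = refl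

rank-bottom≤rank : (B : Bits n) → rank (bottom B) ≤ rank B
rank-bottom≤rank []          = z≤n
rank-bottom≤rank (B ▷ false) = rank-bottom≤rank B
rank-bottom≤rank (B ▷ true) with isTop B
... | true  = m≤n⇒m≤1+n (rank-bottom≤rank B)
... | false = s≤s (rank-bottom≤rank B)

rank+rank-bottom≤length : (B : Bits n) → rank B + rank (bottom B) ≤ n
rank+rank-bottom≤length []          = z≤n
rank+rank-bottom≤length (B ▷ false) = m≤n⇒m≤1+n (rank+rank-bottom≤length B)
rank+rank-bottom≤length (B ▷ true) with isTop B | isTop-reflects B
... | true  | _        = s≤s (rank+rank-bottom≤length B)
... | false | ofⁿ ¬top = s≤s (≤-trans (≤-reflexive (+-suc (rank B) (rank (bottom B))))
                                     (≤∧≢⇒< (rank+rank-bottom≤length B) ¬top))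

top-rank-max : Top C → bottom B ≡ bottom C → rank B ≤ rank C
top-rank-max {C = C} {B = B} top e = +-cancelʳ-≤ (rank (bottom B)) (rank B) (rank C) (begin
  rank B + rank (bottom B) ≤⟨ rank+rank-bottom≤length B ⟩
  _                        ≡⟨ sym top ⟩
  rank C + rank (bottom C) ≡⟨ cong (λ D → rank C + rank D) (sym e) ⟩
  rank C + rank (bottom B) ∎)
  where open ≤-Reasoning

same-bottom⇒⊑ : (B C : Bits n) → bottom B ≡ bottom C → rank B ≤ rank C → B ⊑ C
same-bottom⇒⊑ [] [] _ _ = []
same-bottom⇒⊑ (B ▷ false) (C ▷ false) e le = same-bottom⇒⊑ B C (▷-injectiveˡ e) le ▷⊑ b≤b
same-bottom⇒⊑ (B ▷ false) (C ▷ true)  e le with isTop C | isTop-reflects C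
... | true  | ofʸ top = same-bottom⇒⊑ B C (▷-injectiveˡ e) (top-rank-max top (▷-injectiveˡ e)) ▷⊑ f≤t
same-bottom⇒⊑ (B ▷ false) (C ▷ true) () le | false | _
same-bottom⇒⊑ (B ▷ true) (C ▷ false)  e le with isTop B | isTop-reflects B
... | true  | ofʸ top = ⊥-elim (<-irrefl refl (≤-trans le (top-rank-max top (sym (▷-injectiveˡ e)))))
same-bottom⇒⊑ (B ▷ true) (C ▷ false) () le | false | _
same-bottom⇒⊑ (B ▷ true) (C ▷ true) e (s≤s le) with isTop B | isTop C
... | true  | true  = same-bottom⇒⊑ B C (▷-injectiveˡ e) le ▷⊑ b≤b
... | false | false = same-bottom⇒⊑ B C (▷-injectiveˡ e) le ▷⊑ b≤b
same-bottom⇒⊑ (B ▷ true) (C ▷ true) () (s≤s le) | true  | false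
same-bottom⇒⊑ (B ▷ true) (C ▷ true) () (s≤s le) | false | true

same-bottom⇒comparable : (B C : Bits n) → bottom B ≡ bottom C → B ⊑ C ⊎ C ⊑ B
same-bottom⇒comparable B C e with ≤-total (rank B) (rank C)
... | inj₁ le = inj₁ (same-bottom⇒⊑ B C e le)
... | inj₂ le = inj₂ (same-bottom⇒⊑ C B (sym e) le)

isBottom : Bits n → Bool
isBottom []          = true
isBottom (B ▷ false) = isBottom B
isBottom (B ▷ true)  = isBottom B ∧ not (isTop B)

isBottom⇒bottom≡ : (B : Bits n) → T (isBottom B) → bottom B ≡ B
isBottom⇒bottom≡ []          _ = refl
isBottom⇒bottom≡ (B ▷ false) b = cong (_▷ false) (isBottom⇒bottom≡ B b)
isBottom⇒bottom≡ (B ▷ true)  b =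
  let bB , nonTop = Equivalence.to T-∧ b in
  trans (bottom-▷true-nontop (Equivalence.to (nonTop⇔¬Top B) nonTop))
        (cong (_▷ true) (isBottom⇒bottom≡ B bB))

isBottom-▷true : (B : Bits n) → T (isBottom B) → ¬ Top B → T (isBottom (B ▷ true))
isBottom-▷true B bB ¬top = Equivalence.from T-∧ (bB , Equivalence.from (nonTop⇔¬Top B) ¬top)

isBottom⇒rank+rank≤ : (B : Bits n) → T (isBottom B) → rank B + rank B ≤ n
isBottom⇒rank+rank≤ B bB =
  subst (λ D → rank B + rank D ≤ _) (isBottom⇒bottom≡ B bB) (rank+rank-bottom≤length B)

BelowMiddle : ℕ → Bits n → Set
BelowMiddle m Q = rank Q + rank Q < m

belowMiddle? : (m : ℕ) (Q : Bits n) → Dec (BelowMiddle m Q)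
belowMiddle? m Q = rank Q + rank Q <? m

¬Top⇒bottom-belowMiddle : (B : Bits n) → ¬ Top B → BelowMiddle n (bottom B)
¬Top⇒bottom-belowMiddle B ¬top = ≤-<-trans
  (+-monoʳ-≤ (rank (bottom B)) (rank-bottom≤rank B))
  (≤∧≢⇒< (≤-trans (≤-reflexive (+-comm (rank (bottom B)) (rank B))) (rank+rank-bottom≤length B))
         (λ e → ¬top (trans (+-comm (rank B) (rank (bottom B))) e)))

belowMiddle⇒¬Top : (Q : Bits n) → T (isBottom Q) → BelowMiddle n Q → ¬ Top Q
belowMiddle⇒¬Top Q bQ Q<n top =
  <-irrefl (trans (cong (λ D → rank Q + rank D) (sym (isBottom⇒bottom≡ Q bQ))) top) Q<n

-- From the chain bottoms K of Bits m: each Q in K is again a bottom as Q ▷ false, and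
-- starts a new chain at Q ▷ true when its chain has at least two elements.
nextBottoms : List (Bits m) → List (Bits m) → List (Bits (suc m))
nextBottoms {m} K L = map (_▷ false) K ++ map (_▷ true) (filter (belowMiddle? m) L)

allBottoms : (n : ℕ) → List (Bits n)
allBottoms zero    = [ [] ]
allBottoms (suc m) = nextBottoms (allBottoms m) (allBottoms m)

bottom-∈-allBottoms : (B : Bits n) → bottom B ∈ allBottoms n
bottom-∈-allBottoms []          = here refl
bottom-∈-allBottoms (B ▷ false) = ∈-++⁺ˡ (∈-map⁺ (_▷ false) (bottom-∈-allBottoms B))
bottom-∈-allBottoms {suc m} (B ▷ true) with isTop B | isTop-reflects B
... | true  | _        = ∈-++⁺ˡ (∈-map⁺ (_▷ false) (bottom-∈-allBottoms B))
... | false | ofⁿ ¬top = ∈-++⁺ʳ (map (_▷ false) (allBottoms m)) (∈-map⁺ (_▷ true)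
  (∈-filter⁺ (belowMiddle? m) (bottom-∈-allBottoms B) (¬Top⇒bottom-belowMiddle B ¬top)))

∈-allBottoms⇒isBottom : (n : ℕ) {P : Bits n} → P ∈ allBottoms n → T (isBottom P)
∈-allBottoms⇒isBottom zero (here refl) = _
∈-allBottoms⇒isBottom (suc m) P∈ with ∈-++⁻ (map (_▷ false) (allBottoms m)) P∈
... | inj₁ P∈₀ with ∈-map⁻ (_▷ false) P∈₀
...   | Q , Q∈ , refl = ∈-allBottoms⇒isBottom m Q∈
∈-allBottoms⇒isBottom (suc m) P∈ | inj₂ P∈₁ with ∈-map⁻ (_▷ true) P∈₁
...   | Q , Q∈ , refl with ∈-filter⁻ (belowMiddle? m) Q∈
...     | Q∈′ , Q<m = isBottom-▷true Q bQ (belowMiddle⇒¬Top Q bQ Q<m)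
  where bQ = ∈-allBottoms⇒isBottom m Q∈′

allBottoms-unique : (n : ℕ) → Unique (allBottoms n)
allBottoms-unique zero    = All.[] AllPairs.∷ AllPairs.[]
allBottoms-unique (suc m) = AllPairs.++⁺
  (AllPairs.map⁺ (AllPairs.map (λ ne e → ne (▷-injectiveˡ e)) (allBottoms-unique m)))
  (AllPairs.map⁺ (AllPairs.map (λ ne e → ne (▷-injectiveˡ e))
    (AllPairs.filter⁺ (belowMiddle? m) (allBottoms-unique m))))
  (All.map⁺ (All.tabulate λ _ → All.map⁺ (All.tabulate λ _ ())))

climb : Bits n → ℕ → Bits n
climb []                  t = []
climb {suc m} (Q ▷ false) t with t + rank Q ≤? m
... | yes _ = climb Q t ▷ false
... | no _  = climb Q (pred t) ▷ true
climb (Q ▷ true)          t = climb Q (pred t) ▷ true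

rank∧bottom-climb : (Q : Bits n) (t : ℕ) → T (isBottom Q) → rank Q ≤ t → t + rank Q ≤ n →
                    rank (climb Q t) ≡ t × bottom (climb Q t) ≡ Q
rank∧bottom-climb []                  zero _  _ _ = refl , refl
rank∧bottom-climb {suc m} (Q ▷ false) t    bQ lo hi with t + rank Q ≤? m
... | yes t≤ = Product.map₂ (cong (_▷ false)) (rank∧bottom-climb Q t bQ lo t≤)
rank∧bottom-climb {suc m} (Q ▷ false) zero    bQ lo hi | no t≰ = ⊥-elim (t≰ (≤-trans lo z≤n))
rank∧bottom-climb {suc m} (Q ▷ false) (suc t) bQ lo hi | no t≰ =
  cong suc rank≡ , trans (bottom-▷true-top top) (cong (_▷ false) bottom≡)
  where
  t+rankQ≡m : t + rank Q ≡ m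
  t+rankQ≡m = suc-injective (≤-antisym hi (≰⇒> t≰))
  rankQ≤t : rank Q ≤ t
  rankQ≤t = +-cancelʳ-≤ (rank Q) (rank Q) t
    (subst (rank Q + rank Q ≤_) (sym t+rankQ≡m) (isBottom⇒rank+rank≤ Q bQ))
  IH : rank (climb Q t) ≡ t × bottom (climb Q t) ≡ Q
  IH = rank∧bottom-climb Q t bQ rankQ≤t (≤-reflexive t+rankQ≡m)
  rank≡ : rank (climb Q t) ≡ t
  rank≡ = proj₁ IH
  bottom≡ : bottom (climb Q t) ≡ Q
  bottom≡ = proj₂ IH
  top : Top (climb Q t)
  top = trans (cong₂ (λ r D → r + rank D) rank≡ bottom≡) t+rankQ≡m
rank∧bottom-climb {suc m} (Q ▷ true) (suc t) bQ (s≤s lo) (s≤s hi) =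
  cong suc rank≡ , trans (bottom-▷true-nontop ¬top) (cong (_▷ true) bottom≡)
  where
  t+rankQ<m : t + rank Q < m
  t+rankQ<m = ≤-trans (≤-reflexive (sym (+-suc t (rank Q)))) hi
  IH : rank (climb Q t) ≡ t × bottom (climb Q t) ≡ Q
  IH = rank∧bottom-climb Q t (proj₁ (Equivalence.to T-∧ bQ)) lo (<⇒≤ t+rankQ<m)
  rank≡ : rank (climb Q t) ≡ t
  rank≡ = proj₁ IH
  bottom≡ : bottom (climb Q t) ≡ Q
  bottom≡ = proj₂ IH
  ¬top : ¬ Top (climb Q t)
  ¬top top = <-irrefl (trans (cong₂ (λ r D → r + rank D) (sym rank≡) (sym bottom≡)) top) t+rankQ<m

-- Initial segments of the binary order

-- Precedes true is the binary order <_b (decided at the largest element in which the two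
-- sets differ) and Precedes false is its reflexive closure.
data Precedes (strict : Bool) : {n : ℕ} → Bits n → Bits n → Set where
  nil    : T (not strict) → Precedes strict [] []
  differ : Precedes strict (B ▷ false) (A ▷ true)
  agree  : Precedes strict B A → Precedes strict (B ▷ x) (A ▷ x)

precedes-refl : (A : Bits n) → Precedes false A A
precedes-refl []      = nil _
precedes-refl (A ▷ x) = agree (precedes-refl A)

precedes-nonstrict⇔ : Precedes false B A ⇔ (Precedes true B A ⊎ B ≡ A)
precedes-nonstrict⇔ = mk⇔ to from
  where
  to : Precedes false B A → Precedes true B A ⊎ B ≡ A
  to (nil _)     = inj₂ refl
  to differ      = inj₁ differ
  to (agree B≼A) = Sum.map agree (cong (_▷ _)) (to B≼A)
  from : Precedes true B A ⊎ B ≡ A → Precedes false B A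
  from (inj₁ differ)      = differ
  from (inj₁ (agree B≺A)) = agree (from (inj₁ B≺A))
  from (inj₂ refl)        = precedes-refl _

-- The bottoms of the chains meeting [∅, A) (strict) or [∅, A] (not strict).
bottomsBelow : Bool → Bits n → List (Bits n)
bottomsBelow strict []                 = if strict then [] else [ [] ]
bottomsBelow strict (A ▷ false)        = map (_▷ false) (bottomsBelow strict A)
bottomsBelow {suc m} strict (A ▷ true) = nextBottoms (allBottoms m) (bottomsBelow strict A)

bottom-∈-bottomsBelow : ∀ {strict} → Precedes strict B A → bottom B ∈ bottomsBelow strict A
bottom-∈-bottomsBelow {strict = false} (nil _)  = here refl
bottom-∈-bottomsBelow {B = B ▷ false} differ    = ∈-++⁺ˡ (∈-map⁺ (_▷ false) (bottom-∈-allBottoms B))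
bottom-∈-bottomsBelow (agree {x = false} B≺A)   = ∈-map⁺ (_▷ false) (bottom-∈-bottomsBelow B≺A)
bottom-∈-bottomsBelow {suc m} {B = B ▷ true} (agree {x = true} B≺A) with isTop B | isTop-reflects B
... | true  | _        = ∈-++⁺ˡ (∈-map⁺ (_▷ false) (bottom-∈-allBottoms B))
... | false | ofⁿ ¬top = ∈-++⁺ʳ (map (_▷ false) (allBottoms m)) (∈-map⁺ (_▷ true)
  (∈-filter⁺ (belowMiddle? m) (bottom-∈-bottomsBelow B≺A) (¬Top⇒bottom-belowMiddle B ¬top)))

antichain-length≤ : ∀ {strict} {L : List (Bits n)} → IsAntichain (λ B → Precedes strict B A) L →
                    length L ≤ length (bottomsBelow strict A)
antichain-length≤ {L = L} (below , incomparable) =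
  ≤-trans (≤-reflexive (sym (length-map bottom L)))
          (unique⊆⇒length≤ bottoms-unique (All.map⁺ (All.map bottom-∈-bottomsBelow below)))
  where
  bottoms-unique : Unique (map bottom L)
  bottoms-unique = AllPairs.map⁺ (AllPairs.map
    (λ {B} {C} (B⋢C , C⋢B) e → [ B⋢C , C⋢B ]′ (same-bottom⇒comparable B C e)) incomparable)

rank<? : (R : ℕ) (P : Bits n) → Dec (rank P < R)
rank<? R P = rank P <? R

countRank< : ℕ → List (Bits n) → ℕ
countRank< R L = length (filter (rank<? R) L)

countRank<-zero : (L : List (Bits n)) → countRank< 0 L ≡ 0
countRank<-zero L = cong length (filter-none (rank<? 0) {xs = L} (All.tabulate λ _ ()))

countRank<-length : (L : List (Bits n)) → countRank< (suc n) L ≡ length L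
countRank<-length {n} L =
  cong length (filter-all (rank<? (suc n)) {L} (All.tabulate λ {P} _ → s≤s (rank≤length P)))

countRank<-▷false : ∀ R (L : List (Bits n)) → countRank< R (map (_▷ false) L) ≡ countRank< R L
countRank<-▷false R L = trans (cong length (filter-map (rank<? R) (_▷ false) L))
                              (length-map (_▷ false) (filter (rank<? R) L))

-- A set ending in true has rank < r + 1 iff its restriction has rank < r, and the restriction
-- must be below the middle rank: together, rank < r ⊓ ⌈ m /2⌉.
countRank<-nextBottoms : ∀ r (K L : List (Bits m)) →
  countRank< (suc r) (nextBottoms K L) ≡ countRank< (suc r) K + countRank< (r ⊓ ⌈ m /2⌉) L
countRank<-nextBottoms {m} r K L = begin
  countRank< (suc r) (map (_▷ false) K ++ map (_▷ true) (filter (belowMiddle? m) L))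
    ≡⟨ cong length (filter-++ (rank<? (suc r)) (map (_▷ false) K) _) ⟩
  length (filter (rank<? (suc r)) (map (_▷ false) K) ++ filter (rank<? (suc r)) (map (_▷ true) L′))
    ≡⟨ length-++ (filter (rank<? (suc r)) (map (_▷ false) K)) ⟩
  countRank< (suc r) (map (_▷ false) K) + countRank< (suc r) (map (_▷ true) L′)
    ≡⟨ cong₂ _+_ (countRank<-▷false (suc r) K) (cong length (filter-map (rank<? (suc r)) (_▷ true) L′)) ⟩
  countRank< (suc r) K + length (map (_▷ true) (filter rank+1<? L′))
    ≡⟨ cong (countRank< (suc r) K +_) (length-map (_▷ true) (filter rank+1<? L′)) ⟩
  countRank< (suc r) K + length (filter rank+1<? L′)
    ≡⟨ cong (λ L″ → countRank< (suc r) K + length L″) (sym lower-half) ⟩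
  countRank< (suc r) K + countRank< (r ⊓ ⌈ m /2⌉) L ∎
  where
  open ≡-Reasoning
  L′ = filter (belowMiddle? m) L
  rank+1<? = rank<? (suc r) ∘ (_▷ true)
  lower-half : filter (rank<? (r ⊓ ⌈ m /2⌉)) L ≡ filter rank+1<? L′
  lower-half = trans
    (filter-≐ (rank<? (r ⊓ ⌈ m /2⌉)) (belowMiddle? m ∩? rank+1<?)
      ( (λ P<h → Equivalence.from double<⇔<half (m<n⊓o⇒m<o r _ P<h) , s≤s (m<n⊓o⇒m<n r _ P<h))
      , (λ (P<m/2 , P<r) → ⊓-pres-m< (≤-pred P<r) (Equivalence.to double<⇔<half P<m/2)))
      L)
    (sym (filter-filter rank+1<? (belowMiddle? m) L))

record AntichainBelow (strict : Bool) (A : Bits n) (R : ℕ) : Set where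
  field
    members   : List (Bits n)
    antichain : IsAntichain (λ B → Precedes strict B A × rank B < R) members
    size      : length members ≡ countRank< R (bottomsBelow strict A)

climb-lowBottoms : ∀ m r → All (λ P → rank (climb P (r ⊓ ⌈ m /2⌉)) ≡ r ⊓ ⌈ m /2⌉
                                    × bottom (climb P (r ⊓ ⌈ m /2⌉)) ≡ P)
                               (filter (rank<? (suc r)) (allBottoms m))
climb-lowBottoms m r = All.tabulate λ {P} P∈ →
  let P∈allBottoms , P≤r = ∈-filter⁻ (rank<? (suc r)) P∈
      bP = ∈-allBottoms⇒isBottom m P∈allBottoms
      P≤half = Equivalence.to double≤⇔≤half (isBottom⇒rank+rank≤ P bP)
  in rank∧bottom-climb P (r ⊓ ⌈ m /2⌉) bP
       (⊓-glb (≤-pred P≤r) (≤-trans P≤half (⌊n/2⌋≤⌈n/2⌉ m)))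
       (≤-trans (+-mono-≤ (m⊓n≤n r ⌈ m /2⌉) P≤half)
                (≤-reflexive (trans (+-comm ⌈ m /2⌉ ⌊ m /2⌋) (⌊n/2⌋+⌈n/2⌉≡n m))))

climbed-unique : ∀ {h} {S : List (Bits m)} → Unique S → All (λ P → bottom (climb P h) ≡ P) S →
                 Unique (map (λ P → climb P h ▷ false) S)
climbed-unique {h = h} {S} S! bottom≡ = AllPairs.map (λ ne e → ne (cong bottom e)) (AllPairs.map⁻
  (subst Unique (sym bottoms≡) (AllPairs.map⁺ (AllPairs.map (λ ne e → ne (▷-injectiveˡ e)) S!))))
  where
  bottoms≡ : map bottom (map (λ P → climb P h ▷ false) S) ≡ map (_▷ false) S
  bottoms≡ = trans (sym (map-∘ S)) (map-cong-local (All.map (cong (_▷ false)) bottom≡))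

-- For A ▷ true, every set ending in false precedes A ▷ true, so the chains with bottom ending
-- in false are cut at the common rank h = r ⊓ ⌈ m /2⌉, which they reach while still ending in
-- false; h exceeds the rank of every member of the antichain built recursively (and extended
-- by true) for the chains with bottom ending in true.
antichainBelow : ∀ strict (A : Bits n) R → AntichainBelow strict A R
antichainBelow strict A zero = record
  { members = [] ; antichain = All.[] , AllPairs.[] ; size = sym (countRank<-zero (bottomsBelow strict A)) }
antichainBelow false [] (suc r) = record
  { members   = [ [] ]
  ; antichain = (nil _ , s≤s z≤n) All.∷ All.[] , All.[] AllPairs.∷ AllPairs.[]
  ; size      = refl }
antichainBelow true [] (suc r) = record
  { members = [] ; antichain = All.[] , AllPairs.[] ; size = refl }
antichainBelow strict (A ▷ false) R = record
  { members   = map (_▷ false) members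
  ; antichain = All.map⁺ (All.map (Product.map₁ agree) (proj₁ antichain))
              , AllPairs.map⁺ (AllPairs.map ▷-incomparable (proj₂ antichain))
  ; size      = trans (length-map (_▷ false) members)
                      (trans size (sym (countRank<-▷false R (bottomsBelow strict A)))) }
  where open AntichainBelow (antichainBelow strict A R)
antichainBelow {suc m} strict (A ▷ true) (suc r) = record
  { members   = X ++ Y
  ; antichain = All.++⁺ X-below Y-below
              , AllPairs.++⁺ X-incomparable Y-incomparable X-Y-incomparable
  ; size      = trans (length-++ X) (trans
      (cong₂ _+_ (length-map _ S) (trans (length-map (_▷ true) L) L-size))
      (sym (countRank<-nextBottoms r (allBottoms m) (bottomsBelow strict A)))) }
  where
  h = r ⊓ ⌈ m /2⌉
  open AntichainBelow (antichainBelow strict A h)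
    renaming (members to L; antichain to L-antichain; size to L-size)
  S = filter (rank<? (suc r)) (allBottoms m)
  X = map (λ P → climb P h ▷ false) S
  Y = map (_▷ true) L

  X-incomparable : AllPairs Incomparable X
  X-incomparable = same-rank⇒incomparable (All.map⁺ (All.map proj₁ (climb-lowBottoms m r)))
    (climbed-unique (AllPairs.filter⁺ (rank<? (suc r)) (allBottoms-unique m))
                    (All.map proj₂ (climb-lowBottoms m r)))

  X-below : All (λ B → Precedes strict B (A ▷ true) × rank B < suc r) X
  X-below = All.map⁺ (All.map (λ (rank≡h , _) → differ , s≤s (≤-trans (≤-reflexive rank≡h) (m⊓n≤m r _)))
                              (climb-lowBottoms m r))

  Y-below : All (λ B → Precedes strict B (A ▷ true) × rank B < suc r) Y
  Y-below = All.map⁺ (All.map (λ (B≺A , B<h) → agree B≺A , s≤s (≤-trans B<h (m⊓n≤m r _)))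
                              (proj₁ L-antichain))

  Y-incomparable : AllPairs Incomparable Y
  Y-incomparable = AllPairs.map⁺ (AllPairs.map ▷-incomparable (proj₂ L-antichain))

  X-Y-incomparable : All (λ B → All (Incomparable B) Y) X
  X-Y-incomparable = All.map⁺ (All.map
    (λ (rank≡h , _) → All.map⁺ (All.map
      (λ (_ , C<h) → (λ { (climb⊑C ▷⊑ _) → <-irrefl rank≡h (≤-<-trans (⊑⇒rank≤ climb⊑C) C<h) })
                   , (λ { (_ ▷⊑ ()) }))
      (proj₁ L-antichain)))
    (climb-lowBottoms m r))

selfIfBottom : Bits n → List (Bits n)
selfIfBottom A = if isBottom A then [ A ] else []

selfIfBottom-▷false : (A : Bits n) → map (_▷ false) (selfIfBottom A) ≡ selfIfBottom (A ▷ false)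
selfIfBottom-▷false A with isBottom A
... | true  = refl
... | false = refl

selfIfBottom-▷true : (A : Bits n) →
                     map (_▷ true) (filter (belowMiddle? n) (selfIfBottom A)) ≡ selfIfBottom (A ▷ true)
selfIfBottom-▷true {n} A with isBottom A in bA
... | false = refl
... | true with isTop A | isTop-reflects A
...   | true  | ofʸ top  = cong (map (_▷ true)) (filter-reject (belowMiddle? n)
  λ A<n → belowMiddle⇒¬Top A (Equivalence.from T-≡ bA) A<n top)
...   | false | ofⁿ ¬top = cong (map (_▷ true)) (filter-accept (belowMiddle? n)
  (subst (BelowMiddle n) (isBottom⇒bottom≡ A (Equivalence.from T-≡ bA)) (¬Top⇒bottom-belowMiddle A ¬top)))

bottomsBelow-nonstrict : (A : Bits n) → bottomsBelow false A ≡ bottomsBelow true A ++ selfIfBottom A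
bottomsBelow-nonstrict []          = refl
bottomsBelow-nonstrict (A ▷ false) = begin
  map (_▷ false) (bottomsBelow false A)
    ≡⟨ cong (map (_▷ false)) (bottomsBelow-nonstrict A) ⟩
  map (_▷ false) (bottomsBelow true A ++ selfIfBottom A)
    ≡⟨ map-++ (_▷ false) (bottomsBelow true A) (selfIfBottom A) ⟩
  map (_▷ false) (bottomsBelow true A) ++ map (_▷ false) (selfIfBottom A)
    ≡⟨ cong (map (_▷ false) (bottomsBelow true A) ++_) (selfIfBottom-▷false A) ⟩
  map (_▷ false) (bottomsBelow true A) ++ selfIfBottom (A ▷ false) ∎
  where open ≡-Reasoning
bottomsBelow-nonstrict {suc m} (A ▷ true) = begin
  K ++ raise (bottomsBelow false A)
    ≡⟨ cong (λ L → K ++ raise L) (bottomsBelow-nonstrict A) ⟩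
  K ++ raise (bottomsBelow true A ++ selfIfBottom A)
    ≡⟨ cong (K ++_) (raise-++ (bottomsBelow true A)) ⟩
  K ++ (raise (bottomsBelow true A) ++ raise (selfIfBottom A))
    ≡⟨ sym (++-assoc K _ _) ⟩
  bottomsBelow true (A ▷ true) ++ raise (selfIfBottom A)
    ≡⟨ cong (bottomsBelow true (A ▷ true) ++_) (selfIfBottom-▷true A) ⟩
  bottomsBelow true (A ▷ true) ++ selfIfBottom (A ▷ true) ∎
  where
  open ≡-Reasoning
  K = map (_▷ false) (allBottoms m)
  raise : List (Bits m) → List (Bits (suc m))
  raise L = map (_▷ true) (filter (belowMiddle? m) L)
  raise-++ : (L : List (Bits m)) {L′ : List (Bits m)} → raise (L ++ L′) ≡ raise L ++ raise L′
  raise-++ L {L′} = trans (cong (map (_▷ true)) (filter-++ (belowMiddle? m) L L′))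
                          (map-++ (_▷ true) (filter (belowMiddle? m) L) _)

closure-adds-one⇔isBottom : (A : Bits n) →
  length (bottomsBelow false A) ≡ suc (length (bottomsBelow true A)) ⇔ T (isBottom A)
closure-adds-one⇔isBottom A
  rewrite bottomsBelow-nonstrict A | length-++ (bottomsBelow true A) {selfIfBottom A}
  with isBottom A
... | true  = mk⇔ (λ _ → _) (λ _ → +-comm (length (bottomsBelow true A)) 1)
... | false = mk⇔ (λ e → 1+n≢n (sym (trans (sym (+-identityʳ _)) e))) λ ()

-- The pairing procedure

unpairedZeros : ℕ → Vec Bool n → ℕ
unpairedZeros u []          = u
unpairedZeros u (false ∷ v) = unpairedZeros (suc u) v
unpairedZeros u (true ∷ v)  = unpairedZeros (pred u) v

unpairedZeros-∷ʳ : ∀ u (v : Vec Bool n) b →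
                   unpairedZeros u (v ∷ʳ b) ≡ unpairedZeros (unpairedZeros u v) (b ∷ [])
unpairedZeros-∷ʳ u []          b = refl
unpairedZeros-∷ʳ u (false ∷ v) b = unpairedZeros-∷ʳ (suc u) v b
unpairedZeros-∷ʳ u (true ∷ v)  b = unpairedZeros-∷ʳ (pred u) v b

unpairedOnes-∷ʳ : ∀ u (v : Vec Bool n) b →
                  unpairedOnes u (v ∷ʳ b) ≡ unpairedOnes u v + unpairedOnes (unpairedZeros u v) (b ∷ [])
unpairedOnes-∷ʳ u       []          b = refl
unpairedOnes-∷ʳ u       (false ∷ v) b = unpairedOnes-∷ʳ (suc u) v b
unpairedOnes-∷ʳ zero    (true ∷ v)  b = cong suc (unpairedOnes-∷ʳ zero v b)
unpairedOnes-∷ʳ (suc u) (true ∷ v)  b = unpairedOnes-∷ʳ u v b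

toVec : Bits n → Vec Bool n
toVec []      = []
toVec (B ▷ x) = toVec B ∷ʳ x

unpairedZeros+rank+rank-bottom : (B : Bits n) → unpairedZeros 0 (toVec B) + (rank B + rank (bottom B)) ≡ n
unpairedZeros+rank+rank-bottom []          = refl
unpairedZeros+rank+rank-bottom (B ▷ false) =
  trans (cong (_+ (rank B + rank (bottom B))) (unpairedZeros-∷ʳ 0 (toVec B) false))
        (cong suc (unpairedZeros+rank+rank-bottom B))
unpairedZeros+rank+rank-bottom {suc n} (B ▷ true) with isTop B | isTop-reflects B
... | true  | ofʸ top  =
  trans (cong (_+ suc s) (unpairedZeros-∷ʳ 0 (toVec B) true))
        (paired (unpairedZeros 0 (toVec B)) (unpairedZeros+rank+rank-bottom B))
  where
  s = rank B + rank (bottom B)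
  paired : ∀ z → z + s ≡ n → pred z + suc s ≡ suc n
  paired zero    _ = cong suc top
  paired (suc z) e = ⊥-elim (m≢1+n+m s {z} (sym (trans e (sym top))))
... | false | ofⁿ ¬top =
  trans (cong (_+ (suc (rank B) + suc (rank (bottom B)))) (unpairedZeros-∷ʳ 0 (toVec B) true))
        (unpaired (unpairedZeros 0 (toVec B)) (unpairedZeros+rank+rank-bottom B))
  where
  s = rank B + rank (bottom B)
  unpaired : ∀ z → z + s ≡ n → pred z + (suc (rank B) + suc (rank (bottom B))) ≡ suc n
  unpaired zero    e = ⊥-elim (¬top e)
  unpaired (suc z) e = begin
    z + suc (rank B + suc (rank (bottom B))) ≡⟨ cong (λ k → z + suc k) (+-suc (rank B) (rank (bottom B))) ⟩
    z + suc (suc s)                          ≡⟨ +-suc z (suc s) ⟩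
    suc (z + suc s)                          ≡⟨ cong suc (+-suc z s) ⟩
    suc (suc z + s)                          ≡⟨ cong suc e ⟩
    suc n                                    ∎
    where open ≡-Reasoning

unpairedZeros≡0⇔Top : (B : Bits n) → unpairedZeros 0 (toVec B) ≡ 0 ⇔ Top B
unpairedZeros≡0⇔Top B = mk⇔
  (λ z≡0 → trans (cong (_+ s) (sym z≡0)) invariant)
  (λ top → +-cancelʳ-≡ s (unpairedZeros 0 (toVec B)) 0 (trans invariant (sym top)))
  where
  s = rank B + rank (bottom B)
  invariant = unpairedZeros+rank+rank-bottom B

unpairedOnes-last-true : (B : Bits n) →
  unpairedOnes (unpairedZeros 0 (toVec B)) (true ∷ []) ≡ (if isTop B then 1 else 0)
unpairedOnes-last-true B with isTop B | isTop-reflects B | unpairedZeros 0 (toVec B) | unpairedZeros≡0⇔Top B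
... | true  | _        | zero  | _  = refl
... | true  | ofʸ top  | suc _ | z⇔ with () ← Equivalence.from z⇔ top
... | false | _        | suc _ | _  = refl
... | false | ofⁿ ¬top | zero  | z⇔ = ⊥-elim (¬top (Equivalence.to z⇔ refl))

unpairedOnes≡0⇔isBottom : (B : Bits n) → unpairedOnes 0 (toVec B) ≡ 0 ⇔ T (isBottom B)
unpairedOnes≡0⇔isBottom [] = mk⇔ _ (λ _ → refl)
unpairedOnes≡0⇔isBottom (B ▷ false)
  rewrite unpairedOnes-∷ʳ 0 (toVec B) false | +-identityʳ (unpairedOnes 0 (toVec B)) =
  unpairedOnes≡0⇔isBottom B
unpairedOnes≡0⇔isBottom (B ▷ true)
  rewrite unpairedOnes-∷ʳ 0 (toVec B) true | unpairedOnes-last-true B with isTop B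
... | true  = mk⇔ (λ u+1≡0 → case m+n≡0⇒n≡0 (unpairedOnes 0 (toVec B)) u+1≡0 of λ ())
                  (λ bottom → ⊥-elim (proj₂ (Equivalence.to T-∧ bottom)))
... | false rewrite +-identityʳ (unpairedOnes 0 (toVec B)) = mk⇔
  (λ u≡0 → Equivalence.from T-∧ (Equivalence.to (unpairedOnes≡0⇔isBottom B) u≡0 , _))
  (λ bottom → Equivalence.from (unpairedOnes≡0⇔isBottom B) (proj₁ (Equivalence.to T-∧ bottom)))

-- Subsets as vectors

infixr 5 _◁_
_◁_ : Bool → Bits n → Bits (suc n)
x ◁ []      = [] ▷ x
x ◁ (B ▷ y) = (x ◁ B) ▷ y

fromVec : Vec Bool n → Bits n
fromVec []      = []
fromVec (x ∷ v) = x ◁ fromVec v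

toVec-◁ : (x : Bool) (B : Bits n) → toVec (x ◁ B) ≡ x ∷ toVec B
toVec-◁ x []      = refl
toVec-◁ x (B ▷ y) = cong (_∷ʳ y) (toVec-◁ x B)

toVec-fromVec : (v : Vec Bool n) → toVec (fromVec v) ≡ v
toVec-fromVec []      = refl
toVec-fromVec (x ∷ v) = trans (toVec-◁ x (fromVec v)) (cong (x ∷_) (toVec-fromVec v))

fromVec-∷ʳ : (v : Vec Bool n) (x : Bool) → fromVec (v ∷ʳ x) ≡ fromVec v ▷ x
fromVec-∷ʳ []      x = refl
fromVec-∷ʳ (y ∷ v) x = cong (y ◁_) (fromVec-∷ʳ v x)

fromVec-toVec : (B : Bits n) → fromVec (toVec B) ≡ B
fromVec-toVec []      = refl
fromVec-toVec (B ▷ x) = trans (fromVec-∷ʳ (toVec B) x) (cong (_▷ x) (fromVec-toVec B))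

fromVec-injective : {v w : Vec Bool n} → fromVec v ≡ fromVec w → v ≡ w
fromVec-injective {v = v} {w} e = trans (sym (toVec-fromVec v)) (trans (cong toVec e) (toVec-fromVec w))

∷-⊆-⇔ : {v w : Subset n} → x ∷ v ⊆ y ∷ w ⇔ (x ≤ᵇ y × v ⊆ w)
∷-⊆-⇔ {x = x} {y} = mk⇔ (to x y) from
  where
  to : ∀ x y {v w : Subset _} → x ∷ v ⊆ y ∷ w → x ≤ᵇ y × v ⊆ w
  to false false v⊆w = b≤b , drop-∷-⊆ v⊆w
  to false true  v⊆w = f≤t , drop-∷-⊆ v⊆w
  to true  true  v⊆w = b≤b , drop-∷-⊆ v⊆w
  to true  false v⊆w with () ← v⊆w here
  from : ∀ {x y} {v w : Subset _} → x ≤ᵇ y × v ⊆ w → x ∷ v ⊆ y ∷ w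
  from (f≤t         , v⊆w) = out⊆ v⊆w
  from (b≤b {false} , v⊆w) = out⊆ v⊆w
  from (b≤b {true}  , v⊆w) = in⊆in v⊆w

◁-⊑-⇔ : x ◁ B ⊑ y ◁ C ⇔ (x ≤ᵇ y × B ⊑ C)
◁-⊑-⇔ = mk⇔ to from
  where
  to : x ◁ B ⊑ y ◁ C → x ≤ᵇ y × B ⊑ C
  to {B = []}    {C = []}    ([] ▷⊑ x≤y)  = x≤y , []
  to {B = _ ▷ _} {C = _ ▷ _} (B⊑C ▷⊑ b≤c) = Product.map₂ (_▷⊑ b≤c) (to B⊑C)
  from : x ≤ᵇ y × B ⊑ C → x ◁ B ⊑ y ◁ C
  from (x≤y , [])          = [] ▷⊑ x≤y
  from (x≤y , B⊑C ▷⊑ b≤c) = from (x≤y , B⊑C) ▷⊑ b≤c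

⊆⇔⊑ : {v w : Subset n} → v ⊆ w ⇔ fromVec v ⊑ fromVec w
⊆⇔⊑ {v = []}    {[]}    = mk⇔ (λ _ → []) (λ _ {i} → case i of λ ())
⊆⇔⊑ {v = x ∷ v} {y ∷ w} = ⇔-trans ∷-⊆-⇔ (⇔-trans
  (mk⇔ (Product.map₂ (Equivalence.to ⊆⇔⊑)) (Product.map₂ (Equivalence.from ⊆⇔⊑)))
  (⇔-sym ◁-⊑-⇔))

∉-△-self : (v : Subset n) (j : Fin n) → j ∉ˢ v △ v
∉-△-self v j = subst (j ∉ˢ_) (sym (△-self v)) ∉⊥
  where
  △-self : (v : Subset n) → v △ v ≡ Data.Fin.Subset.⊥
  △-self []      = refl
  △-self (x ∷ v) = cong₂ _∷_ (xor-same x) (△-self v)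

△-empty⇒≡ : {v w : Subset n} → (∀ j → j ∉ˢ v △ w) → v ≡ w
△-empty⇒≡ {v = []}    {[]}    _     = refl
△-empty⇒≡ {v = x ∷ v} {y ∷ w} empty =
  cong₂ _∷_ (head x y (empty zero)) (△-empty⇒≡ (λ j → empty (suc j) ∘ there))
  where
  head : ∀ x y → zero ∉ˢ (x xor y) ∷ (v △ w) → x ≡ y
  head false false _     = refl
  head true  true  _     = refl
  head false true  zero∉ = ⊥-elim (zero∉ here)
  head true  false zero∉ = ⊥-elim (zero∉ here)

∷-<b-⇔ : {v w : Subset n} → (x ∷ v) <b (y ∷ w) ⇔ (v <b w ⊎ (v ≡ w × x ≡ false × y ≡ true))
∷-<b-⇔ = mk⇔ to from
  where
  to : {v w : Subset n} → (x ∷ v) <b (y ∷ w) → v <b w ⊎ (v ≡ w × x ≡ false × y ≡ true)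
  to {x = false} {y = true} (zero , _ , max , _) =
    inj₂ (△-empty⇒≡ (λ j j∈ → case max (suc j) (there j∈) of λ ()) , refl , refl)
  to {x = true}  {y = true} (zero , () , _ , _)
  to {y = false}            (zero , _ , _ , ())
  to (suc i , i∈ , max , i∈w) =
    inj₁ (i , drop-there i∈ , (λ j j∈ → ≤-pred (max (suc j) (there j∈))) , drop-there i∈w)
  from : {v w : Subset n} → v <b w ⊎ (v ≡ w × x ≡ false × y ≡ true) → (x ∷ v) <b (y ∷ w)
  from {x = x} {y} {v} {w} (inj₁ (i , i∈ , max , i∈w)) = suc i , there i∈ , max′ , there i∈w
    where
    max′ : ∀ j → j ∈ˢ (x ∷ v) △ (y ∷ w) → j Data.Fin.≤ suc i
    max′ zero    _  = z≤n
    max′ (suc j) j∈ = s≤s (max j (drop-there j∈))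
  from {n} {v = v} (inj₂ (refl , refl , refl)) = zero , here , max′ , here
    where
    max′ : ∀ j → j ∈ˢ (false ∷ v) △ (true ∷ v) → j Data.Fin.≤ zero {n}
    max′ zero    _  = z≤n
    max′ (suc j) j∈ = ⊥-elim (∉-△-self v j (drop-there j∈))

◁-precedes-⇔ : Precedes true (x ◁ B) (y ◁ C) ⇔ (Precedes true B C ⊎ (B ≡ C × x ≡ false × y ≡ true))
◁-precedes-⇔ = mk⇔ to from
  where
  to : Precedes true (x ◁ B) (y ◁ C) → Precedes true B C ⊎ (B ≡ C × x ≡ false × y ≡ true)
  to {B = []}    {C = []}    differ           = inj₂ (refl , refl , refl)
  to {B = []}    {C = []}    (agree (nil ()))
  to {B = _ ▷ _} {C = _ ▷ _} differ           = inj₁ differ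
  to {B = _ ▷ _} {C = _ ▷ _} (agree B≺C)      = Sum.map agree (Product.map₁ (cong (_▷ _))) (to B≺C)
  from : Precedes true B C ⊎ (B ≡ C × x ≡ false × y ≡ true) → Precedes true (x ◁ B) (y ◁ C)
  from (inj₁ differ)                            = differ
  from (inj₁ (agree B≺C))                       = agree (from (inj₁ B≺C))
  from {B = []}    (inj₂ (refl , refl , refl)) = differ
  from {B = _ ▷ _} (inj₂ (refl , refl , refl)) = agree (from (inj₂ (refl , refl , refl)))

<b⇔precedes : {v w : Subset n} → v <b w ⇔ Precedes true (fromVec v) (fromVec w)
<b⇔precedes {v = []}    {[]}    = mk⇔ (λ ()) (λ { (nil ()) })
<b⇔precedes {v = x ∷ v} {y ∷ w} = mk⇔
  (Equivalence.from ◁-precedes-⇔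
    ∘ Sum.map (Equivalence.to <b⇔precedes) (Product.map₁ (cong fromVec))
    ∘ Equivalence.to ∷-<b-⇔)
  (Equivalence.from ∷-<b-⇔
    ∘ Sum.map (Equivalence.from <b⇔precedes) (Product.map₁ fromVec-injective)
    ∘ Equivalence.to ◁-precedes-⇔)

isWidth-bottomsBelow : ∀ strict (A : Bits n) (X : Subset n → Set) →
                       (∀ V → X V ⇔ Precedes strict (fromVec V) A) →
                       IsWidth X (length (bottomsBelow strict A))
isWidth-bottomsBelow {n} strict A X X⇔ =
  (map toVec members , (X-members , incomparable-members) , members-size) , antichain-bound
  where
  open AntichainBelow (antichainBelow strict A (suc n))

  toVec-⊆⇔⊑ : (B C : Bits n) → toVec B ⊆ toVec C ⇔ B ⊑ C
  toVec-⊆⇔⊑ B C =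
    subst₂ (λ B′ C′ → toVec B ⊆ toVec C ⇔ B′ ⊑ C′) (fromVec-toVec B) (fromVec-toVec C) ⊆⇔⊑

  X-members : All X (map toVec members)
  X-members = All.map⁺ (All.map (λ {B} (B≺A , _) → Equivalence.from (X⇔ (toVec B))
    (subst (λ B′ → Precedes strict B′ A) (sym (fromVec-toVec B)) B≺A)) (proj₁ antichain))

  incomparable-members : AllPairs (λ V W → ¬ V ⊆ W × ¬ W ⊆ V) (map toVec members)
  incomparable-members = AllPairs.map⁺ (AllPairs.map (λ {B} {C} (B⋢C , C⋢B) →
    B⋢C ∘ Equivalence.to (toVec-⊆⇔⊑ B C) , C⋢B ∘ Equivalence.to (toVec-⊆⇔⊑ C B)) (proj₂ antichain))

  members-size : length (map toVec members) ≡ length (bottomsBelow strict A)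
  members-size = trans (length-map toVec members) (trans size (countRank<-length (bottomsBelow strict A)))

  antichain-bound : ∀ L → IsAntichainIn X L → length L ≤ length (bottomsBelow strict A)
  antichain-bound L (X-L , incomparable-L) = ≤-trans (≤-reflexive (sym (length-map fromVec L)))
    (antichain-length≤
      ( All.map⁺ (All.map (λ {V} → Equivalence.to (X⇔ V)) X-L)
      , AllPairs.map⁺ (AllPairs.map
          (λ (V⊈W , W⊈V) → V⊈W ∘ Equivalence.from ⊆⇔⊑ , W⊈V ∘ Equivalence.from ⊆⇔⊑) incomparable-L)))

proposition6 : ∀ (n : ℕ) (A : Subset n) →
    ∃ λ (k : ℕ) → ∃ λ (m : ℕ) →
      IsWidth (closed A) k × IsWidth (halfOpen A) m ×
      ((k ≡ suc m) ⇔ Special A)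
proposition6 n A =
  length (bottomsBelow false Â) , length (bottomsBelow true Â) ,
  isWidth-bottomsBelow false Â (closed A) closed⇔ ,
  isWidth-bottomsBelow true Â (halfOpen A) (λ V → <b⇔precedes) ,
  ⇔-trans (closure-adds-one⇔isBottom Â) (⇔-sym special⇔isBottom)
  where
  Â = fromVec A
  closed⇔ : ∀ V → closed A V ⇔ Precedes false (fromVec V) Â
  closed⇔ V = ⇔-trans
    (mk⇔ (Sum.map (Equivalence.to <b⇔precedes) (cong fromVec))
         (Sum.map (Equivalence.from <b⇔precedes) fromVec-injective))
    (⇔-sym precedes-nonstrict⇔)
  special⇔isBottom : Special A ⇔ T (isBottom Â)
  special⇔isBottom =
    subst (λ V → unpairedOnes 0 V ≡ 0 ⇔ T (isBottom Â)) (toVec-fromVec A) (unpairedOnes≡0⇔isBottom Â)
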